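{- Let $\mathcal P$ be a $d$-floorplan with bounding box $[0,1]^d$ and let $q$ be a pushable corner of axis $i$. Let $\mathcal P'$ be the child of $\mathcal P$ with respect to $q$. Then the set of pushable corners of $\mathcal P'$ equals the set of pushable corners of $\mathcal P$ that are not shadowed by $q$, together with $\{q_{new}^j : 1\le j\le d\}$.
   Context: A $d$-dimensional floorplan is $[0,1]^d$ partitioned into finitely many boxes (blocks) with disjoint interiors; a facet of axis $j$ is an axis-parallel hyperrectangle with degenerate $j$-th interval; the border of axis $j$ at $0<t<1$ is the union of block facets of axis $j$ lying in $\{x_j=t\}$; a $d$-floorplan is one where every border is a single facet and no two borders have intersecting relative interiors. Each block has a lower and an upper facet of axis $j$ (with $j$-th coordinate its minimal, resp. maximal, $j$-th coordinate). Let $q_{\max}=(1,\dots,1)$. A pushable facet of axis $i$ is a facet of axis $i$ contained in the face $\{x_i=1\}$ of $[0,1]^d$, containing $q_{\max}$, which is a union of upper facets of axis $i$ of blocks. A pushable corner of axis $i$ is the minimal corner $q$ of a pushable facet of axis $i$, denoted $f_q$ (so $f_q$ is the hyperrectangle between $q$ and $q_{\max}$). For a pushable corner $q$ of axis $i$, choose $\alpha>0$ with $1-\alpha$ larger than the position of every border of axis $i$; the child $\mathcal P'$ of $\mathcal P$ with respect to $q$ (block insertion) is obtained by lowering to $1-\alpha$ the upper $i$-th coordinate of every block whose upper facet of axis $i$ lies in $f_q$, and adding the new block with minimal corner $q_{new}$ and maximal corner $q_{\max}$, where $q_{new}$ is $q$ with its $i$-th coordinate replaced by $1-\alpha$. For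 $1\le j\le d$, $q_{new}^j$ is $q_{new}$ with its $j$-th coordinate replaced by $1$. A pushable corner $q'=(x'_1,\dots,x'_d)$ of axis $i'$ is shadowed by the pushable corner $q=(x_1,\dots,x_d)$ of axis $i$ if there is $k\notin\{i,i'\}$ with $x'_k>x_k$.
   Formalization: Every block of $\mathcal P$, every facet and every corner has rational coordinates, and the value $1-\alpha$ is rational. -}

module Defs where

open import Data.Nat using (ℕ; suc)
open import Data.Fin using (Fin; zero; suc) renaming (_≟_ to _≟F_)
open import Data.Fin.Properties using (all?)
open import Data.Fin.Subset using (Subset) renaming (_∈_ to _∈ₛ_)
open import Data.Rational using (ℚ; 0ℚ; 1ℚ; _≤_; _<_)
open import Data.Rational.Properties using (_≤?_)
open import Data.Product using (Σ; ∃; _×_; _,_)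
open import Data.Sum using (_⊎_)
open import Relation.Binary.PropositionalEquality using (_≡_; _≢_)
open import Relation.Nullary using (¬_; yes; no)
open import Relation.Nullary.Decidable using (_×-dec_)
open import Function.Bundles using (_⇔_)

Point : ℕ → Set
Point d = Fin d → ℚ

qmax : ∀ {d} → Point d
qmax _ = 1ℚ

upd : ∀ {d} → Point d → Fin d → ℚ → Point d
upd x j v k with k ≟F j
... | yes _ = v
... | no  _ = x k

record Box (d : ℕ) : Set where
  constructor box
  field
    lo : Point d
    hi : Point d
open Box public

_∈R_ : ∀ {d} → Point d → Box d → Set
x ∈R B = ∀ k → lo B k ≤ x k × x k ≤ hi B k

_⊆R_ : ∀ {d} → Box d → Box d → Set
A ⊆R B = ∀ k → lo B k ≤ lo A k × hi A k ≤ hi B k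

IsFacet : ∀ {d} → Fin d → Box d → Set
IsFacet j F = lo F j ≡ hi F j × (∀ k → k ≢ j → lo F k < hi F k)

_∈relint[_]_ : ∀ {d} → Point d → Fin d → Box d → Set
x ∈relint[ j ] F = x j ≡ lo F j × (∀ k → k ≢ j → lo F k < x k × x k < hi F k)

lowerFacet : ∀ {d} → Box d → Fin d → Box d
lowerFacet b j = box (lo b) (upd (hi b) j (lo b j))

upperFacet : ∀ {d} → Box d → Fin d → Box d
upperFacet b j = box (upd (lo b) j (hi b j)) (hi b)

Blocks : ℕ → ℕ → Set
Blocks d n = Fin n → Box d

InUnitCube : ∀ {d} → Point d → Set
InUnitCube x = ∀ k → 0ℚ ≤ x k × x k ≤ 1ℚ

IsFloorplan : ∀ {d n} → Blocks d n → Set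
IsFloorplan {d} {n} P =
    (∀ b k → 0ℚ ≤ lo (P b) k × lo (P b) k < hi (P b) k × hi (P b) k ≤ 1ℚ)
  × (∀ (x : Point d) → InUnitCube x → ∃ λ b → x ∈R P b)
  × (∀ a b → a ≢ b → ¬ (Σ (Point d) λ x →
        (∀ k → lo (P a) k < x k × x k < hi (P a) k)
      × (∀ k → lo (P b) k < x k × x k < hi (P b) k)))

InBorder : ∀ {d n} → Blocks d n → Fin d → ℚ → Point d → Set
InBorder P j t x = ∃ λ b →
    (lo (P b) j ≡ t × x ∈R lowerFacet (P b) j)
  ⊎ (hi (P b) j ≡ t × x ∈R upperFacet (P b) j)

IsBorder : ∀ {d n} → Blocks d n → Fin d → ℚ → Set
IsBorder {d} P j t = 0ℚ < t × t < 1ℚ × Σ (Point d) (InBorder P j t)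

BorderIsFacet : ∀ {d n} → Blocks d n → Fin d → ℚ → Box d → Set
BorderIsFacet P j t F = IsFacet j F × (∀ x → InBorder P j t x ⇔ x ∈R F)

IsDFloorplan : ∀ {d n} → Blocks d n → Set
IsDFloorplan {d} P =
    IsFloorplan P
  × (∀ j t → IsBorder P j t → Σ (Box d) (BorderIsFacet P j t))
  × (∀ j t j' t' F F' → IsBorder P j t → IsBorder P j' t'
       → BorderIsFacet P j t F → BorderIsFacet P j' t' F'
       → (j ≢ j' ⊎ t ≢ t')
       → ¬ (Σ (Point d) λ x → x ∈relint[ j ] F × x ∈relint[ j' ] F'))

PushableFacet : ∀ {d n} → Blocks d n → Fin d → Box d → Set
PushableFacet {d} {n} P i F =
    IsFacet i F
  × (∀ k → 0ℚ ≤ lo F k) × (∀ k → hi F k ≤ 1ℚ) × lo F i ≡ 1ℚ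
  × qmax ∈R F
  × Σ (Subset n) λ S → ∀ x → x ∈R F ⇔ (∃ λ b → b ∈ₛ S × x ∈R upperFacet (P b) i)

PushableCorner : ∀ {d n} → Blocks d n → Fin d → Point d → Set
PushableCorner {d} P i q = Σ (Box d) λ F → PushableFacet P i F × (∀ k → lo F k ≡ q k)

fq : ∀ {d} → Point d → Box d
fq q = box q qmax

-- q_new = q with i-th coordinate replaced by t (t plays the role of 1 - α)
qnew : ∀ {d} → Point d → Fin d → ℚ → Point d
qnew q i t = upd q i t

qnewj : ∀ {d} → Point d → Fin d → ℚ → Fin d → Point d
qnewj q i t j = upd (qnew q i t) j 1ℚ

pushBlock : ∀ {d} → Fin d → Point d → ℚ → Box d → Box d
pushBlock i q t b with all? (λ k → (lo (fq q) k ≤? lo (upperFacet b i) k)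
                                   ×-dec (hi (upperFacet b i) k ≤? hi (fq q) k))
... | yes _ = box (lo b) (upd (hi b) i t)
... | no  _ = b

-- child of P with respect to q (axis i), with 1 - α = t; block 0 is the new block
child : ∀ {d n} → Blocks d n → Fin d → Point d → ℚ → Blocks d (suc n)
child P i q t zero    = box (qnew q i t) qmax
child P i q t (suc b) = pushBlock i q t (P b)

Shadowed : ∀ {d} → Fin d → Point d → Fin d → Point d → Set
Shadowed i' q' i q = ∃ λ k → k ≢ i × k ≢ i' × q k < q' k

{-# OPTIONS --safe #-}
-- A point r is a pushable corner of axis j iff 0 ≤ r, r_j = 1, r_k < 1 for k ≠ j, and the box f_r
-- is covered by upper facets of axis j of blocks lying inside f_r. In the child, the pushed blocks
-- end at t in coordinate i while every block starts below t there, and the new block contributes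
-- the facet f_{q_new^j} for every axis j. An old corner r therefore stays covered exactly when the new
-- facet may replace the lowered ones, i.e. when r ≤ q_new^j, which for an old corner means that q
-- does not shadow r. Conversely every corner r of the child satisfies r ≤ q_new^j, because q_max
-- lies on the new block. If r_i = t no old facet fits inside f_r, so r = q_new^j; otherwise, where
-- f_r meets the new facet it is covered in P by pushed blocks, and disjointness of interiors
-- forces their upper facets inside f_r.
module Submission where

open import Defs
open import Data.Nat using (ℕ; suc)
open import Data.Fin using (Fin; zero; suc) renaming (_≟_ to _≟F_)
open import Data.Fin.Properties using (all?)
open import Data.Fin.Subset using (Subset) renaming (_∈_ to _∈ₛ_)
open import Data.Rational using (ℚ; 0ℚ; 1ℚ; _≤_; _<_)
open import Data.Rational.Properties
  using (≤-refl; ≤-reflexive; ≤-trans; ≤-antisym; ≤-total; <-trans; <-≤-trans; ≤-<-trans;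
         <⇒≤; ≮⇒≥; ≰⇒>; <-irrefl; <-dense; <-cmp; _≤?_; _<?_)
open import Data.Product using (∃; _×_; _,_; proj₁; proj₂)
open import Data.Sum using (_⊎_; inj₁; inj₂)
open import Data.Bool.Properties using (T-≡)
open import Data.Vec using (tabulate)
open import Data.Vec.Properties using (lookup∘tabulate; lookup⇒[]=; []=⇒lookup)
open import Relation.Binary.Definitions using (tri<; tri≈; tri>)
open import Relation.Binary.PropositionalEquality
  using (_≡_; _≢_; refl; sym; trans; cong; cong₂; subst; subst₂; ≢-sym)
open import Relation.Nullary using (¬_; Dec; yes; no; contradiction)
open import Relation.Nullary.Decidable using (_×-dec_; isYes; toWitness; fromWitness)
open import Function.Bundles using (_⇔_; mk⇔; Equivalence)

private variable
  d n : ℕ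

<⇒≱ : {a b : ℚ} → a < b → ¬ b ≤ a
<⇒≱ a<b b≤a = <-irrefl refl (<-≤-trans a<b b≤a)

common-point : {a b a′ b′ : ℚ} → a < b → a < b′ → a′ < b → a′ < b′ →
               ∃ λ z → (a < z × z < b) × (a′ < z × z < b′)
common-point {a} {b} {a′} {b′} a<b a<b′ a′<b a′<b′ with ≤-total a a′ | ≤-total b b′
... | inj₁ a≤a′ | inj₁ b≤b′ = let z , a′<z , z<b = <-dense a′<b in
  z , (≤-<-trans a≤a′ a′<z , z<b) , (a′<z , <-≤-trans z<b b≤b′)
... | inj₁ a≤a′ | inj₂ b′≤b = let z , a′<z , z<b′ = <-dense a′<b′ in
  z , (≤-<-trans a≤a′ a′<z , <-≤-trans z<b′ b′≤b) , (a′<z , z<b′)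
... | inj₂ a′≤a | inj₁ b≤b′ = let z , a<z , z<b = <-dense a<b in
  z , (a<z , z<b) , (≤-<-trans a′≤a a<z , <-≤-trans z<b b≤b′)
... | inj₂ a′≤a | inj₂ b′≤b = let z , a<z , z<b′ = <-dense a<b′ in
  z , (a<z , <-≤-trans z<b′ b′≤b) , (≤-<-trans a′≤a a<z , z<b′)

_≤ₚ_ : Point d → Point d → Set
x ≤ₚ y = ∀ k → x k ≤ y k

upd-≡ : (x : Point d) (j : Fin d) (v : ℚ) → upd x j v j ≡ v
upd-≡ x j v with j ≟F j
... | yes _   = refl
... | no j≢j = contradiction refl j≢j

upd-≢ : (x : Point d) {j k : Fin d} (v : ℚ) → k ≢ j → upd x j v k ≡ x k
upd-≢ x {j} {k} v k≢j with k ≟F j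
... | yes k≡j = contradiction k≡j k≢j
... | no _    = refl

upd-elim : (R : Fin d → ℚ → Set) {x : Point d} {j : Fin d} {v : ℚ} →
           R j v → (∀ k → k ≢ j → R k (x k)) → ∀ k → R k (upd x j v k)
upd-elim R {j = j} Rj Rk k with k ≟F j
... | yes refl = Rj
... | no k≢j   = Rk k k≢j

upd²-elim : (R : Fin d → ℚ → Set) {x : Point d} {i j : Fin d} {u v : ℚ} →
            R j v → (i ≢ j → R i u) → (∀ k → k ≢ i → k ≢ j → R k (x k)) →
            ∀ k → R k (upd (upd x i u) j v k)
upd²-elim R {j = j} Rj Ri Rk =
  upd-elim R Rj (λ k k≢j → upd-elim (λ k a → k ≢ j → R k a) Ri (λ k k≢i → Rk k k≢i) k k≢j)

module _ {B : Box d} {j : Fin d} where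

  ∈upperFacet : {x : Point d} → hi B j ≤ x j → (∀ k → k ≢ j → lo B k ≤ x k) → x ≤ₚ hi B →
                x ∈R upperFacet B j
  ∈upperFacet {x} top lo≤x x≤hi k = upd-elim (λ k a → a ≤ x k) top lo≤x k , x≤hi k

  ∈upperFacet-lo : {x : Point d} → x ∈R upperFacet B j → ∀ {k} → k ≢ j → lo B k ≤ x k
  ∈upperFacet-lo {x} x∈ {k} k≢j = subst (_≤ x k) (upd-≢ (lo B) (hi B j) k≢j) (proj₁ (x∈ k))

  upperFacet⊆fq : {r : Point d} → r j ≤ hi B j → (∀ k → k ≢ j → r k ≤ lo B k) → hi B ≤ₚ qmax →
                  upperFacet B j ⊆R fq r
  upperFacet⊆fq {r} top r≤lo hi≤1 k = upd-elim (λ k a → r k ≤ a) top r≤lo k , hi≤1 k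

  upperFacet⊆fq-top : {r : Point d} → upperFacet B j ⊆R fq r → r j ≤ hi B j
  upperFacet⊆fq-top {r} ⊆fq = subst (r j ≤_) (upd-≡ (lo B) j (hi B j)) (proj₁ (⊆fq j))

  upperFacet⊆fq-lo : {r : Point d} → upperFacet B j ⊆R fq r → ∀ {k} → k ≢ j → r k ≤ lo B k
  upperFacet⊆fq-lo {r} ⊆fq {k} k≢j = subst (r k ≤_) (upd-≢ (lo B) (hi B j) k≢j) (proj₁ (⊆fq k))

corners⇒⊆R : {A B : Box d} → lo A ∈R B → hi A ∈R B → A ⊆R B
corners⇒⊆R lo∈ hi∈ k = proj₁ (lo∈ k) , proj₂ (hi∈ k)

lo∈R : {x : Point d} {B : Box d} → x ∈R B → lo B ∈R B
lo∈R x∈ k = ≤-refl , ≤-trans (proj₁ (x∈ k)) (proj₂ (x∈ k))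

hi∈R : {x : Point d} {B : Box d} → x ∈R B → hi B ∈R B
hi∈R x∈ k = ≤-trans (proj₁ (x∈ k)) (proj₂ (x∈ k)) , ≤-refl

⊆R-trans : {A B C : Box d} → A ⊆R B → B ⊆R C → A ⊆R C
⊆R-trans A⊆B B⊆C k =
  ≤-trans (proj₁ (B⊆C k)) (proj₁ (A⊆B k)) , ≤-trans (proj₂ (A⊆B k)) (proj₂ (B⊆C k))

fq-antitone : {r s : Point d} → r ≤ₚ s → fq s ⊆R fq r
fq-antitone r≤s k = r≤s k , ≤-refl

TopCorner : Fin d → Point d → Set
TopCorner j r = (∀ k → 0ℚ ≤ r k) × r j ≡ 1ℚ × (∀ k → k ≢ j → r k < 1ℚ)

UpperFacetCover : Blocks d n → Fin d → Point d → Set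
UpperFacetCover P j r =
  ∀ x → x ∈R fq r → ∃ λ b → upperFacet (P b) j ⊆R fq r × x ∈R upperFacet (P b) j

module _ {j : Fin d} {r : Point d} (rc : TopCorner j r) where

  TopCorner-≤1 : r ≤ₚ qmax
  TopCorner-≤1 k with k ≟F j
  ... | yes refl = ≤-reflexive (proj₁ (proj₂ rc))
  ... | no k≢j   = <⇒≤ (proj₂ (proj₂ rc) k k≢j)

  corner∈fq : r ∈R fq r
  corner∈fq k = ≤-refl , TopCorner-≤1 k

  qmax∈fq : qmax ∈R fq r
  qmax∈fq k = TopCorner-≤1 k , ≤-refl

  ∈fq⇒1≤ : ∀ {x} → x ∈R fq r → 1ℚ ≤ x j
  ∈fq⇒1≤ {x} x∈ = subst (_≤ x j) (proj₁ (proj₂ rc)) (proj₁ (x∈ j))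

pushableCorner⇒ : {P : Blocks d n} {j : Fin d} {r : Point d} →
                  PushableCorner P j r → TopCorner j r × UpperFacetCover P j r
pushableCorner⇒ {P = P} {j} {r} (F , ((_ , F<) , F≥0 , F≤1 , Fj≡1 , qmax∈F , S , F⇔S) , F≡r) =
  ((λ k → subst (0ℚ ≤_) (F≡r k) (F≥0 k)) , trans (sym (F≡r j)) Fj≡1 ,
   λ k k≢j → subst₂ _<_ (F≡r k) (hiF≡1 k) (F< k k≢j)) ,
  cover
  where
  hiF≡1 : ∀ k → hi F k ≡ 1ℚ
  hiF≡1 k = ≤-antisym (F≤1 k) (proj₂ (qmax∈F k))

  fq⇒F : ∀ {x} → x ∈R fq r → x ∈R F
  fq⇒F {x} x∈ k = subst (_≤ x k) (sym (F≡r k)) (proj₁ (x∈ k)) ,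
                  subst (x k ≤_) (sym (hiF≡1 k)) (proj₂ (x∈ k))

  F⇒fq : ∀ {x} → x ∈R F → x ∈R fq r
  F⇒fq {x} x∈ k = subst (_≤ x k) (F≡r k) (proj₁ (x∈ k)) , subst (x k ≤_) (hiF≡1 k) (proj₂ (x∈ k))

  cover : UpperFacetCover P j r
  cover x x∈ with Equivalence.to (F⇔S x) (fq⇒F x∈)
  ... | b , b∈S , x∈b = b , corners⇒⊆R (facet⇒fq (lo∈R x∈b)) (facet⇒fq (hi∈R x∈b)) , x∈b
    where
    facet⇒fq : ∀ {y} → y ∈R upperFacet (P b) j → y ∈R fq r
    facet⇒fq y∈ = F⇒fq (Equivalence.from (F⇔S _) (b , b∈S , y∈))

-- The subset of blocks in PushableCorner can be taken to be all blocks whose upper facet lies in f_r.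
pushableCorner⇐ : {P : Blocks d n} {j : Fin d} {r : Point d} →
                  TopCorner j r → UpperFacetCover P j r → PushableCorner P j r
pushableCorner⇐ {n = n} {P = P} {j} {r} rc@(r≥0 , rj≡1 , r<1) cover =
  fq r , ((rj≡1 , r<1) , r≥0 , (λ _ → ≤-refl) , rj≡1 , qmax∈fq rc , S , λ x → mk⇔ (to x) (from x)) ,
  λ _ → refl
  where
  inside? : ∀ b → Dec (upperFacet (P b) j ⊆R fq r)
  inside? b = all? (λ k → (r k ≤? lo (upperFacet (P b) j) k) ×-dec (hi (P b) k ≤? 1ℚ))

  S : Subset n
  S = tabulate (λ b → isYes (inside? b))

  to : ∀ x → x ∈R fq r → ∃ λ b → b ∈ₛ S × x ∈R upperFacet (P b) j
  to x x∈ with cover x x∈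
  ... | b , ⊆fq , x∈b =
    b , lookup⇒[]= b S (trans (lookup∘tabulate _ b) (Equivalence.to T-≡ (fromWitness ⊆fq))) , x∈b

  from : ∀ x → (∃ λ b → b ∈ₛ S × x ∈R upperFacet (P b) j) → x ∈R fq r
  from x (b , b∈S , x∈b) k =
    ≤-trans (proj₁ (⊆fq k)) (proj₁ (x∈b k)) , ≤-trans (proj₂ (x∈b k)) (proj₂ (⊆fq k))
    where
    ⊆fq : upperFacet (P b) j ⊆R fq r
    ⊆fq = toWitness {a? = inside? b}
            (Equivalence.from T-≡ (trans (sym (lookup∘tabulate _ b)) ([]=⇒lookup b∈S)))

module Floorplan {P : Blocks d n} (fp : IsFloorplan P) where

  lo<hi : ∀ b k → lo (P b) k < hi (P b) k
  lo<hi b k = proj₁ (proj₂ (proj₁ fp b k))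

  hi≤1 : ∀ b → hi (P b) ≤ₚ qmax
  hi≤1 b k = proj₂ (proj₂ (proj₁ fp b k))

  lo<1 : ∀ b k → lo (P b) k < 1ℚ
  lo<1 b k = <-≤-trans (lo<hi b k) (hi≤1 b k)

  overlap⇒≡ : ∀ a b → (∀ k → lo (P a) k < hi (P b) k × lo (P b) k < hi (P a) k) → a ≡ b
  overlap⇒≡ a b inter with a ≟F b
  ... | yes a≡b = a≡b
  ... | no a≢b  =
    contradiction (z , (λ k → proj₁ (z∈ k)) , (λ k → proj₂ (z∈ k))) (proj₂ (proj₂ fp) a b a≢b)
    where
    meet : ∀ k → ∃ λ z → (lo (P a) k < z × z < hi (P a) k) × (lo (P b) k < z × z < hi (P b) k)
    meet k = common-point (lo<hi a k) (proj₁ (inter k)) (proj₂ (inter k)) (lo<hi b k)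

    z : Point d
    z k = proj₁ (meet k)

    z∈ : ∀ k → (lo (P a) k < z k × z k < hi (P a) k) × (lo (P b) k < z k × z k < hi (P b) k)
    z∈ k = proj₂ (meet k)

  shared-top⇒≡ : ∀ {j w} a b →
                 (∀ k → k ≢ j → lo (P a) k ≤ w k) → w ≤ₚ hi (P a) → 1ℚ ≤ w j →
                 (∀ k → k ≢ j → lo (P b) k < w k × w k < hi (P b) k) → 1ℚ ≤ hi (P b) j →
                 a ≡ b
  shared-top⇒≡ {j} {w} a b lo≤w w≤hi 1≤wj w-inside b-top = overlap⇒≡ a b meet
    where
    meet : ∀ k → lo (P a) k < hi (P b) k × lo (P b) k < hi (P a) k
    meet k with k ≟F j
    ... | yes refl = <-≤-trans (lo<1 a j) b-top , <-≤-trans (lo<1 b j) (≤-trans 1≤wj (w≤hi j))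
    ... | no k≢j   = ≤-<-trans (lo≤w k k≢j) (proj₂ (w-inside k k≢j)) ,
                     <-≤-trans (proj₁ (w-inside k k≢j)) (w≤hi k)

  top-unique : ∀ a b → qmax ≤ₚ hi (P a) → qmax ≤ₚ hi (P b) → a ≡ b
  top-unique a b a-top b-top =
    overlap⇒≡ a b (λ k → <-≤-trans (lo<1 a k) (b-top k) , <-≤-trans (lo<1 b k) (a-top k))

  -- A lower facet not on the boundary of the cube lies in a border.
  borders<⇒lo< : ∀ {i t} → 0ℚ < t → (∀ s → IsBorder P i s → s < t) → ∀ b → lo (P b) i < t
  borders<⇒lo< {i} {t} 0<t borders<t b with <-cmp 0ℚ (lo (P b) i)
  ... | tri< 0<lo _ _ = borders<t (lo (P b) i) (0<lo , lo<1 b i , lo (P b) , b , inj₁ (refl , lo∈))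
    where
    lo∈ : lo (P b) ∈R lowerFacet (P b) i
    lo∈ k = ≤-refl , upd-elim (λ k a → lo (P b) k ≤ a) ≤-refl (λ k _ → <⇒≤ (lo<hi b k)) k
  ... | tri≈ _ 0≡lo _ = subst (_< t) 0≡lo 0<t
  ... | tri> _ _ lo<0 = contradiction (proj₁ (proj₁ fp b i)) (<⇒≱ lo<0)

module Child (P : Blocks d n) (i : Fin d) (q : Point d) (t : ℚ) where

  P′ : Blocks d (suc n)
  P′ = child P i q t

  Pushed : Fin n → Set
  Pushed b = upperFacet (P b) i ⊆R fq q

  push-cases : ∀ b → (Pushed b × P′ (suc b) ≡ box (lo (P b)) (upd (hi (P b)) i t))
                   ⊎ (¬ Pushed b × P′ (suc b) ≡ P b)
  push-cases b with all? (λ k → (lo (fq q) k ≤? lo (upperFacet (P b) i) k)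
                                 ×-dec (hi (upperFacet (P b) i) k ≤? hi (fq q) k))
  ... | yes pushed = inj₁ (pushed , refl)
  ... | no ¬pushed = inj₂ (¬pushed , refl)

  child-lo : ∀ b → lo (P′ (suc b)) ≡ lo (P b)
  child-lo b with push-cases b
  ... | inj₁ (_ , eq) = cong lo eq
  ... | inj₂ (_ , eq) = cong lo eq

  child-hi-≢ : ∀ b {k} → k ≢ i → hi (P′ (suc b)) k ≡ hi (P b) k
  child-hi-≢ b {k} k≢i with push-cases b
  ... | inj₁ (_ , eq) = trans (cong (λ B → hi B k) eq) (upd-≢ (hi (P b)) t k≢i)
  ... | inj₂ (_ , eq) = cong (λ B → hi B k) eq

  child-hi-pushed : ∀ {b} → Pushed b → hi (P′ (suc b)) i ≡ t
  child-hi-pushed {b} pushed with push-cases b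
  ... | inj₁ (_ , eq)      = trans (cong (λ B → hi B i) eq) (upd-≡ (hi (P b)) i t)
  ... | inj₂ (¬pushed , _) = contradiction pushed ¬pushed

  child-upperFacet-lo : ∀ b {j} → j ≢ i → lo (upperFacet (P′ (suc b)) j) ≡ lo (upperFacet (P b) j)
  child-upperFacet-lo b {j} j≢i = cong₂ (λ l h → upd l j h) (child-lo b) (child-hi-≢ b j≢i)

  qnewj-i : ∀ {j} → i ≢ j → qnewj q i t j i ≡ t
  qnewj-i i≢j = trans (upd-≢ (qnew q i t) 1ℚ i≢j) (upd-≡ q i t)

  qnewj-≢ : ∀ {j k} → k ≢ i → k ≢ j → qnewj q i t j k ≡ q k
  qnewj-≢ k≢i k≢j = trans (upd-≢ (qnew q i t) 1ℚ k≢j) (upd-≢ q t k≢i)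

module Insertion {P : Blocks d n} (fp : IsFloorplan P) {i : Fin d} {q : Point d}
                 (pcq : PushableCorner P i q) {t : ℚ} (0<t : 0ℚ < t) (t<1 : t < 1ℚ)
                 (lo<t : ∀ b → lo (P b) i < t) where

  open Floorplan fp
  open Child P i q t

  q-corner : TopCorner i q
  q-corner = proj₁ (pushableCorner⇒ pcq)

  q-cover : UpperFacetCover P i q
  q-cover = proj₂ (pushableCorner⇒ pcq)

  qi≡1 : q i ≡ 1ℚ
  qi≡1 = proj₁ (proj₂ q-corner)

  pushed-top : ∀ {b} → Pushed b → 1ℚ ≤ hi (P b) i
  pushed-top pushed = subst (_≤ _) qi≡1 (upperFacet⊆fq-top pushed)

  child-hi≤ : ∀ b → hi (P′ (suc b)) ≤ₚ hi (P b)
  child-hi≤ b k with k ≟F i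
  ... | no k≢i = ≤-reflexive (child-hi-≢ b k≢i)
  ... | yes refl with push-cases b
  ...   | inj₁ (pushed , _) = subst (_≤ hi (P b) i) (sym (child-hi-pushed pushed))
                                    (≤-trans (<⇒≤ t<1) (pushed-top pushed))
  ...   | inj₂ (_ , eq)     = ≤-reflexive (cong (λ B → hi B i) eq)

  child-lo<t : ∀ b → lo (P′ (suc b)) i < t
  child-lo<t b = subst (λ l → l i < t) (sym (child-lo b)) (lo<t b)

  facet⊆fq⇒<t : ∀ {B j r} → lo B i < t → i ≢ j → upperFacet B j ⊆R fq r → r i < t
  facet⊆fq⇒<t lo<t i≢j ⊆fq = ≤-<-trans (upperFacet⊆fq-lo ⊆fq i≢j) lo<t

  top-block-pushed : ∀ {b} → qmax ≤ₚ hi (P b) → Pushed b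
  top-block-pushed {b} b-top with q-cover qmax (qmax∈fq q-corner)
  ... | b₀ , pushed , qmax∈ = subst Pushed (top-unique b₀ b (λ k → proj₂ (qmax∈ k)) b-top) pushed

  -- q_max lies on the new block: pushed blocks end at t < 1 and the block of P at q_max is pushed.
  ≤qnewj : ∀ {j r} → TopCorner j r → UpperFacetCover P′ j r → r ≤ₚ qnewj q i t j
  ≤qnewj rc cover with cover qmax (qmax∈fq rc)
  ... | zero , ⊆fq , _ = λ k → proj₁ (⊆fq k)
  ... | suc b , _ , qmax∈ with push-cases b
  ...   | inj₁ (pushed , _)       =
    contradiction (subst (1ℚ ≤_) (child-hi-pushed pushed) (proj₂ (qmax∈ i))) (<⇒≱ t<1)
  ...   | inj₂ (¬pushed , P′b≡Pb) =
    contradiction (top-block-pushed (λ k → subst (λ B → 1ℚ ≤ hi B k) P′b≡Pb (proj₂ (qmax∈ k))))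
                  ¬pushed

  ≤qnewj⇒¬shadowed : ∀ {j r} → r ≤ₚ qnewj q i t j → ¬ Shadowed j r i q
  ≤qnewj⇒¬shadowed {r = r} r≤ (k , k≢i , k≢j , qk<rk) =
    <⇒≱ qk<rk (subst (r k ≤_) (qnewj-≢ k≢i k≢j) (r≤ k))

  -- An old facet inside f_r would start at r_i ≥ t, but every old block starts below t.
  corner-at-t : ∀ {j r} → j ≢ i → TopCorner j r → UpperFacetCover P′ j r → t ≤ r i →
                ∀ k → r k ≡ qnewj q i t j k
  corner-at-t {r = r} j≢i rc cover t≤ri with cover r (corner∈fq rc)
  ... | zero , _ , r∈    = λ k → ≤-antisym (≤qnewj rc cover k) (proj₁ (r∈ k))
  ... | suc b , ⊆fq , _ = contradiction t≤ri (<⇒≱ (facet⊆fq⇒<t (child-lo<t b) (≢-sym j≢i) ⊆fq))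

  qnewi≡q : ∀ k → qnewj q i t i k ≡ q k
  qnewi≡q = upd²-elim (λ k a → a ≡ q k) (sym qi≡1) (λ i≢i → contradiction refl i≢i)
                      (λ _ _ _ → refl)

  q≤qnewj : ∀ {j} k → k ≢ i → q k ≤ qnewj q i t j k
  q≤qnewj {j} = upd²-elim (λ k a → k ≢ i → q k ≤ a) (λ _ → TopCorner-≤1 q-corner j)
                          (λ _ i≢i → contradiction refl i≢i) (λ _ _ _ _ → ≤-refl)

  raise∈fq-q : ∀ {j x} → x ∈R fq (qnewj q i t j) → upd x i 1ℚ ∈R fq q
  raise∈fq-q x∈new =
    upd-elim (λ k a → q k ≤ a × a ≤ 1ℚ) (TopCorner-≤1 q-corner i , ≤-refl)
             (λ k k≢i → ≤-trans (q≤qnewj k k≢i) (proj₁ (x∈new k)) , proj₂ (x∈new k))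

  child-facet⇒facet : ∀ {j r x} b → r j ≡ 1ℚ → x ∈R fq r →
                      upperFacet (P′ (suc b)) j ⊆R fq r → x ∈R upperFacet (P′ (suc b)) j →
                      upperFacet (P b) j ⊆R fq r × x ∈R upperFacet (P b) j
  child-facet⇒facet {j} {r} {x} b rj≡1 x∈ ⊆fq x∈′ with j ≟F i
  ... | no j≢i =
    (λ k → subst (λ l → r k ≤ l k) (child-upperFacet-lo b j≢i) (proj₁ (⊆fq k)) , hi≤1 b k) ,
    (λ k → subst (λ l → l k ≤ x k) (child-upperFacet-lo b j≢i) (proj₁ (x∈′ k)) ,
           ≤-trans (proj₂ (x∈′ k)) (child-hi≤ b k))
  ... | yes refl with push-cases b
  ...   | inj₂ (_ , P′b≡Pb) =
    subst (λ B → upperFacet B i ⊆R fq r × x ∈R upperFacet B i) P′b≡Pb (⊆fq , x∈′)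
  ...   | inj₁ (pushed , _) =
    contradiction (subst₂ _≤_ rj≡1 (child-hi-pushed pushed) (≤-trans (proj₁ (x∈ i)) (proj₂ (x∈′ i))))
                  (<⇒≱ t<1)

  facet⇒child-facet : ∀ {j r x} b → j ≢ i → x i ≤ hi (P′ (suc b)) i →
                      upperFacet (P b) j ⊆R fq r → x ∈R upperFacet (P b) j →
                      upperFacet (P′ (suc b)) j ⊆R fq r × x ∈R upperFacet (P′ (suc b)) j
  facet⇒child-facet {j} {r} {x} b j≢i xi≤ ⊆fq x∈ =
    (λ k → subst (λ l → r k ≤ l k) (sym (child-upperFacet-lo b j≢i)) (proj₁ (⊆fq k)) ,
           ≤-trans (child-hi≤ b k) (hi≤1 b k)) ,
    (λ k → subst (λ l → l k ≤ x k) (sym (child-upperFacet-lo b j≢i)) (proj₁ (x∈ k)) , x≤hi k)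
    where
    x≤hi : x ≤ₚ hi (P′ (suc b))
    x≤hi k with k ≟F i
    ... | yes refl = xi≤
    ... | no k≢i   = subst (x k ≤_) (sym (child-hi-≢ b k≢i)) (proj₂ (x∈ k))

  cover-axis-i : ∀ {r} → TopCorner i r → UpperFacetCover P′ i r → UpperFacetCover P i r
  cover-axis-i {r} rc cover x x∈ with cover x x∈
  ... | suc b , ⊆fq , x∈′ = b , child-facet⇒facet b (proj₁ (proj₂ rc)) x∈ ⊆fq x∈′
  ... | zero , _ , x∈new
        with q-cover x (λ k → subst (_≤ x k) (qnewi≡q k) (proj₁ (x∈new k)) , proj₂ (x∈new k))
  ...   | b , ⊆fq , x∈b = b , ⊆R-trans ⊆fq (fq-antitone r≤q) , x∈b
    where
    r≤q : r ≤ₚ q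
    r≤q k = subst (r k ≤_) (qnewi≡q k) (≤qnewj rc cover k)

  corner≤pushed-lo : ∀ {j r b} → j ≢ i → TopCorner j r → UpperFacetCover P′ j r → r i < t →
                     Pushed b → 1ℚ ≤ hi (P b) j → (∀ k → k ≢ i → k ≢ j → r k ≤ lo (P b) k) →
                     r i ≤ lo (P b) i
  corner≤pushed-lo {j} {r} {b} j≢i rc cover ri<t pushed b-top r≤lo = ≮⇒≥ impossible
    where
    mid : ∀ k → ∃ λ z → lo (P b) k < z × z < hi (P b) k
    mid k = <-dense (lo<hi b k)

    w : Point d
    w = upd (upd (λ k → proj₁ (mid k)) i (r i)) j 1ℚ

    w∈ : w ∈R fq r
    w∈ = upd²-elim (λ k a → r k ≤ a × a ≤ 1ℚ) (TopCorner-≤1 rc j , ≤-refl)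
                   (λ _ → ≤-refl , <⇒≤ (<-trans ri<t t<1))
                   (λ k k≢i k≢j → <⇒≤ (≤-<-trans (r≤lo k k≢i k≢j) (proj₁ (proj₂ (mid k)))) ,
                                  <⇒≤ (<-≤-trans (proj₂ (proj₂ (mid k))) (hi≤1 b k)))

    w-inside : lo (P b) i < r i → ∀ k → k ≢ j → lo (P b) k < w k × w k < hi (P b) k
    w-inside lo<ri = upd²-elim (λ k a → k ≢ j → lo (P b) k < a × a < hi (P b) k)
                               (λ j≢j → contradiction refl j≢j)
                               (λ _ _ → lo<ri , <-≤-trans (<-trans ri<t t<1) (pushed-top pushed))
                               (λ k _ _ _ → proj₂ (mid k))

    w-i : w i ≡ r i
    w-i = trans (upd-≢ _ 1ℚ (≢-sym j≢i)) (upd-≡ _ i (r i))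

    -- w lies in f_r and in the relative interior of b's top facet, so the block of P′ covering w
    -- is neither the new block (its facet starts at t > r_i) nor an old block other than b; and
    -- b's facet inside f_r would force r_i ≤ lo (P b) i.
    impossible : ¬ lo (P b) i < r i
    impossible lo<ri with cover w w∈
    ... | zero , _ , w∈new = <⇒≱ ri<t (subst₂ _≤_ (qnewj-i (≢-sym j≢i)) w-i (proj₁ (w∈new i)))
    ... | suc c , ⊆fq , w∈c = <⇒≱ lo<ri (subst (λ c → r i ≤ lo (P c) i) c≡b ri≤lo-c)
      where
      ri≤lo-c : r i ≤ lo (P c) i
      ri≤lo-c = subst (λ l → r i ≤ l i) (child-lo c) (upperFacet⊆fq-lo ⊆fq (≢-sym j≢i))

      c≡b : c ≡ b
      c≡b = shared-top⇒≡ c b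
              (λ k k≢j → subst (λ l → l k ≤ w k) (child-lo c) (∈upperFacet-lo w∈c k≢j))
              (λ k → ≤-trans (proj₂ (w∈c k)) (child-hi≤ c k))
              (≤-reflexive (sym (upd-≡ _ j 1ℚ))) (w-inside lo<ri) b-top

  newFacet-covered : ∀ {j r x} → j ≢ i → TopCorner j r → UpperFacetCover P′ j r → r i < t →
                     x ∈R fq r → x ∈R fq (qnewj q i t j) →
                     ∃ λ b → upperFacet (P b) j ⊆R fq r × x ∈R upperFacet (P b) j
  newFacet-covered {j} {r} {x} j≢i rc cover ri<t x∈ x∈new
    with q-cover (upd x i 1ℚ) (raise∈fq-q x∈new)
  ... | b , pushed , x↑∈b =
    b , upperFacet⊆fq (subst (_≤ hi (P b) j) (sym (proj₁ (proj₂ rc))) b-top) r≤lo (hi≤1 b) ,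
    ∈upperFacet (≤-trans (hi≤1 b j) (∈fq⇒1≤ rc x∈)) lo≤x x≤hi
    where
    x↑-≢ : ∀ {k} → k ≢ i → upd x i 1ℚ k ≡ x k
    x↑-≢ = upd-≢ x 1ℚ

    b-top : 1ℚ ≤ hi (P b) j
    b-top = ≤-trans (∈fq⇒1≤ rc x∈) (subst (_≤ hi (P b) j) (x↑-≢ j≢i) (proj₂ (x↑∈b j)))

    lo≤x : ∀ k → k ≢ j → lo (P b) k ≤ x k
    lo≤x k k≢j with k ≟F i
    ... | yes refl =
      <⇒≤ (<-≤-trans (lo<t b) (subst (_≤ x i) (qnewj-i (≢-sym j≢i)) (proj₁ (x∈new i))))
    ... | no k≢i   = subst (lo (P b) k ≤_) (x↑-≢ k≢i) (∈upperFacet-lo x↑∈b k≢i)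

    x≤hi : x ≤ₚ hi (P b)
    x≤hi k with k ≟F i
    ... | yes refl = ≤-trans (proj₂ (x∈ i)) (pushed-top pushed)
    ... | no k≢i   = subst (_≤ hi (P b) k) (x↑-≢ k≢i) (proj₂ (x↑∈b k))

    r≤lo-off-i : ∀ k → k ≢ i → k ≢ j → r k ≤ lo (P b) k
    r≤lo-off-i k k≢i k≢j =
      ≤-trans (subst (r k ≤_) (qnewj-≢ k≢i k≢j) (≤qnewj rc cover k)) (upperFacet⊆fq-lo pushed k≢i)

    r≤lo : ∀ k → k ≢ j → r k ≤ lo (P b) k
    r≤lo k k≢j with k ≟F i
    ... | yes refl = corner≤pushed-lo j≢i rc cover ri<t pushed b-top r≤lo-off-i
    ... | no k≢i   = r≤lo-off-i k k≢i k≢j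

  cover-below-t : ∀ {j r} → j ≢ i → TopCorner j r → UpperFacetCover P′ j r → r i < t →
                  UpperFacetCover P j r
  cover-below-t j≢i rc cover ri<t x x∈ with cover x x∈
  ... | zero , _ , x∈new  = newFacet-covered j≢i rc cover ri<t x∈ x∈new
  ... | suc b , ⊆fq , x∈′ = b , child-facet⇒facet b (proj₁ (proj₂ rc)) x∈ ⊆fq x∈′

  ¬shadowed⇒≤qnewj : ∀ {j r} → TopCorner j r → UpperFacetCover P j r → ¬ Shadowed j r i q →
                     r ≤ₚ qnewj q i t j
  ¬shadowed⇒≤qnewj {j} {r} rc cover ¬shadowed =
    upd²-elim (λ k a → r k ≤ a) (TopCorner-≤1 rc j) ri≤t
              (λ k k≢i k≢j → ≮⇒≥ (λ qk<rk → ¬shadowed (k , k≢i , k≢j , qk<rk)))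
    where
    ri≤t : i ≢ j → r i ≤ t
    ri≤t i≢j with cover r (corner∈fq rc)
    ... | b , ⊆fq , _ = <⇒≤ (facet⊆fq⇒<t (lo<t b) i≢j ⊆fq)

  cover-child : ∀ {j r} → TopCorner j r → UpperFacetCover P j r → r ≤ₚ qnewj q i t j →
                UpperFacetCover P′ j r
  cover-child {j} {r} rc cover r≤qn x x∈ with cover x x∈
  ... | b , ⊆fq , x∈b with push-cases b | x i ≤? t
  ...   | inj₂ (_ , P′b≡Pb) | _ =
    suc b , subst (λ B → upperFacet B j ⊆R fq r × x ∈R upperFacet B j) (sym P′b≡Pb) (⊆fq , x∈b)
  ...   | inj₁ (pushed , _) | yes xi≤t =
    suc b , facet⇒child-facet b j≢i (subst (x i ≤_) (sym (child-hi-pushed pushed)) xi≤t) ⊆fq x∈b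
    where
    j≢i : j ≢ i
    j≢i refl = <⇒≱ t<1 (≤-trans (∈fq⇒1≤ rc x∈) xi≤t)
  ...   | inj₁ (pushed , _) | no xi≰t = zero , (λ k → r≤qn k , ≤-refl) , x∈new
    where
    x∈new : x ∈R fq (qnewj q i t j)
    x∈new k =
      upd²-elim (λ k a → a ≤ x k) (∈fq⇒1≤ rc x∈) (λ _ → <⇒≤ (≰⇒> xi≰t))
                (λ k k≢i k≢j → ≤-trans (upperFacet⊆fq-lo pushed k≢i) (∈upperFacet-lo x∈b k≢j)) k ,
      proj₂ (x∈ k)

  qnewj-pushable : ∀ {j r} → (∀ k → r k ≡ qnewj q i t j k) → PushableCorner P′ j r
  qnewj-pushable {j} {r} r≡qn = pushableCorner⇐ (r≥0 , trans (r≡qn j) (upd-≡ _ j 1ℚ) , r<1) cover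
    where
    r≥0 : ∀ k → 0ℚ ≤ r k
    r≥0 k = subst (0ℚ ≤_) (sym (r≡qn k))
                  (upd²-elim (λ _ a → 0ℚ ≤ a) (<⇒≤ (<-trans 0<t t<1)) (λ _ → <⇒≤ 0<t)
                             (λ k _ _ → proj₁ q-corner k) k)

    r<1 : ∀ k → k ≢ j → r k < 1ℚ
    r<1 k k≢j = subst (_< 1ℚ) (sym (r≡qn k))
                      (upd²-elim (λ k a → k ≢ j → a < 1ℚ) (λ j≢j → contradiction refl j≢j)
                                 (λ _ _ → t<1) (λ k k≢i _ _ → proj₂ (proj₂ q-corner) k k≢i)
                                 k k≢j)

    cover : UpperFacetCover P′ j r
    cover x x∈ = zero , (λ k → ≤-reflexive (r≡qn k) , ≤-refl) ,
                 (λ k → subst (_≤ x k) (r≡qn k) (proj₁ (x∈ k)) , proj₂ (x∈ k))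

lemma3 : ∀ {d n} (P : Blocks d n) → IsDFloorplan P
    → (i : Fin d) (q : Point d) → PushableCorner P i q
    → (t : ℚ) → 0ℚ < t → t < 1ℚ → (∀ s → IsBorder P i s → s < t)
    → ∀ (i' : Fin d) (q' : Point d)
    → PushableCorner (child P i q t) i' q'
      ⇔ ((PushableCorner P i' q' × ¬ Shadowed i' q' i q)
         ⊎ (∀ k → q' k ≡ qnewj q i t i' k))
lemma3 P (fp , _) i q pcq t 0<t t<1 borders<t j r = mk⇔ forward backward
  where
  open Floorplan fp using (borders<⇒lo<)
  open Insertion fp pcq 0<t t<1 (borders<⇒lo< 0<t borders<t)

  forward : PushableCorner (child P i q t) j r →
            (PushableCorner P j r × ¬ Shadowed j r i q) ⊎ (∀ k → r k ≡ qnewj q i t j k)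
  forward pc with pushableCorner⇒ pc
  ... | rc , cover with j ≟F i | r i <? t
  ...   | yes refl | _       = inj₁ (pushableCorner⇐ rc (cover-axis-i rc cover) ,
                                     ≤qnewj⇒¬shadowed (≤qnewj rc cover))
  ...   | no j≢i  | yes ri<t = inj₁ (pushableCorner⇐ rc (cover-below-t j≢i rc cover ri<t) ,
                                     ≤qnewj⇒¬shadowed (≤qnewj rc cover))
  ...   | no j≢i  | no ri≮t  = inj₂ (corner-at-t j≢i rc cover (≮⇒≥ ri≮t))

  backward : (PushableCorner P j r × ¬ Shadowed j r i q) ⊎ (∀ k → r k ≡ qnewj q i t j k) →
             PushableCorner (child P i q t) j r
  backward (inj₁ (pc , ¬shadowed)) with pushableCorner⇒ pc
  ... | rc , cover =
    pushableCorner⇐ rc (cover-child rc cover (¬shadowed⇒≤qnewj rc cover ¬shadowed))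
  backward (inj₂ r≡qn) = qnewj-pushable r≡qn
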